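{- In the setting below, let $F$ be a function and $(A_n)_{n\ge0}$ a sequence with $F(x)=\sum_{n\ge0}A_nx^n$. Then $F(0)=1$ and $F$ satisfies $$\left(1+\sum_{j=1}^{r}\left(d^{j-1}\sum_{\substack{\alpha<a(r)\\ w(\alpha)=j-1}}q^{\alpha}+d^{j}\sum_{\substack{\alpha<a(r)\\ w(\alpha)=j}}q^{\alpha}\right)(-x)^j\right)F(x)=F(xq^N)+\sum_{j=1}^{r}\sum_{l=1}^{r}\sum_{k=0}^{\min(j-1,l-1)}c_{k,j}b_{l-k,j}(-1)^{l-1}x^lF\left(xq^{jN}\right)$$ if and only if $A_0=1$ and for all $n\ge1$ $$\left(1-q^{nN}\right)A_n=\sum_{m=1}^{r}\left(d^{m-1}\sum_{\substack{\alpha<a(r)\\ w(\alpha)=m-1}}q^{\alpha}+d^{m}\sum_{\substack{\alpha<a(r)\\ w(\alpha)=m}}q^{\alpha}+\sum_{j=1}^{r}\sum_{k=0}^{\min(j-1,m-1)}c_{k,j}b_{m-k,j}q^{jN(n-m)}\right)(-1)^{m+1}A_{n-m}.$$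
   Context: Let $r\ge1$, let $A=\{a(1),\dots,a(r)\}$ be a set of $r$ distinct integers with $\sum_{i=1}^{k-1}a(i)<a(k)$ for $1\le k\le r$ and with the $2^r-1$ sums of nonempty subsets pairwise distinct; let $A'$ be the set of these sums, $N\ge a(1)+\dots+a(r)$ an integer, and $a(r+1):=N+a(1)$. $d,q$ are fixed with $|d|,|q|<1$. For $\alpha\in A'$, $w(\alpha)$ is the number of elements of $A$ in the unique subset summing to $\alpha$. A sum $\sum_{\alpha<c,\,w(\alpha)=n}q^\alpha$ runs over $\alpha\in A'$ with $\alpha<c$, $w(\alpha)=n$; it equals $1$ when $n=0$ and $0$ when there is no such $\alpha$. ${m\brack s}_q=\prod_{i=1}^{s}\frac{1-q^{m-s+i}}{1-q^i}$ if $0\le s\le m$, else $0$. $c_{k,j}:=q^{N\frac{k(k+1)}{2}+ka(r)}{j-1\brack k}_{q^N}d^k$ and $b_{m,j}:=\left(d^{m-1}\sum_{\alpha<a(r+1),\,w(\alpha)=j+m-1}q^{\alpha}+d^{m}\sum_{\alpha<a(r+1),\,w(\alpha)=j+m}q^{\alpha}\right){j+m-1\brack m-1}_{q^N}$. In the recurrence, $A_j:=0$ for $j<0$. -}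

module Defs where

open import Level using (Level)
open import Data.Bool using (Bool; true; false; if_then_else_; _∧_)
open import Data.Nat using (ℕ; zero; suc; _+_; _*_; _∸_; _≤_; _<_; _≤ᵇ_; _<ᵇ_; _≡ᵇ_; _⊓_; _/_)
open import Data.List using (List; []; _∷_; _++_; map; foldr)
open import Data.Vec using (Vec; []; _∷_)
open import Data.Fin.Subset using (Subset; ∣_∣)
open import Algebra.Bundles using (CommutativeRing)

natSum : ℕ → ℕ → (ℕ → ℕ) → ℕ
natSum lo hi f = go (suc hi ∸ lo)
  where
  go : ℕ → ℕ
  go zero    = 0
  go (suc t) = go t + f (lo + t)

allSubsets : (n : ℕ) → List (Subset n)
allSubsets zero    = [] ∷ []
allSubsets (suc n) = map (false ∷_) (allSubsets n) ++ map (true ∷_) (allSubsets n)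

-- Subset sum: position i (i : Fin r, 0-based) stands for the paper's a(i+1).
subsetSumFrom : (ℕ → ℕ) → ℕ → {n : ℕ} → Subset n → ℕ
subsetSumFrom a off []          = 0
subsetSumFrom a off (b ∷ S) = (if b then a (suc off) else 0) + subsetSumFrom a (suc off) S

subsetSum : (ℕ → ℕ) → {n : ℕ} → Subset n → ℕ
subsetSum a S = subsetSumFrom a 0 S

module Setting {c ℓ : Level} (R : CommutativeRing c ℓ)
               (q d : CommutativeRing.Carrier R) (a : ℕ → ℕ) (r N : ℕ) where
  open CommutativeRing R renaming (_+_ to _⊕_; _*_ to _⊗_)

  _−_ : Carrier → Carrier → Carrier
  x − y = x ⊕ (- y)

  pow : Carrier → ℕ → Carrier
  pow x zero    = 1#
  pow x (suc n) = x ⊗ pow x n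

  Σ[_,_] : ℕ → ℕ → (ℕ → Carrier) → Carrier
  Σ[ lo , hi ] f = go (suc hi ∸ lo)
    where
    go : ℕ → Carrier
    go zero    = 0#
    go (suc t) = go t ⊕ f (lo + t)

  sumList : List Carrier → Carrier
  sumList = foldr _⊕_ 0#

  -- Gaussian binomial coefficient [m choose s]_Q (q-Pascal recursion;
  -- equals the product formula whenever the latter is defined).
  qbin : Carrier → ℕ → ℕ → Carrier
  qbin Q m       zero    = 1#
  qbin Q zero    (suc s) = 0#
  qbin Q (suc m) (suc s) = qbin Q m s ⊕ pow Q (suc s) ⊗ qbin Q m (suc s)

  -- a(r+1) := N + a(1)
  aNext : ℕ
  aNext = N + a 1

  -- Σ_{α < bound, w(α) = n} q^α  over α ∈ A' (sums of nonempty subsets);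
  -- equals 1 when n = 0.
  σ : ℕ → ℕ → Carrier
  σ bound zero    = 1#
  σ bound (suc n) = sumList (map term (allSubsets r))
    where
    term : Subset r → Carrier
    term S = if (∣ S ∣ ≡ᵇ suc n) ∧ (subsetSum a S <ᵇ bound)
             then pow q (subsetSum a S) else 0#

  cc : ℕ → ℕ → Carrier
  cc k j = pow q (N * ((k * suc k) / 2) + k * a r) ⊗ qbin (pow q N) (j ∸ 1) k ⊗ pow d k

  bb : ℕ → ℕ → Carrier
  bb m j = (pow d (m ∸ 1) ⊗ σ aNext (j + m ∸ 1) ⊕ pow d m ⊗ σ aNext (j + m))
           ⊗ qbin (pow q N) (j + m ∸ 1) (m ∸ 1)

  ee : ℕ → Carrier
  ee j = pow d (j ∸ 1) ⊗ σ (a r) (j ∸ 1) ⊕ pow d j ⊗ σ (a r) j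

  sgn : ℕ → Carrier
  sgn n = pow (- 1#) n

  -- Formal power series = coefficient sequences ℕ → Carrier
  Series : Set c
  Series = ℕ → Carrier

  -- coefficient series of the polynomial 1 + Σ_{j=1}^r ee j (-x)^j
  P : Series
  P zero    = 1#
  P (suc j) = if suc j ≤ᵇ r then ee (suc j) ⊗ sgn (suc j) else 0#

  _⊛_ : Series → Series → Series
  (f ⊛ g) n = Σ[ 0 , n ] (λ i → f i ⊗ g (n ∸ i))

  -- F(x) ↦ F(x·u)
  dilate : Carrier → Series → Series
  dilate u f n = pow u n ⊗ f n

  -- F(x) ↦ x^l F(x)
  shift : ℕ → Series → Series
  shift l f n = if l ≤ᵇ n then f (n ∸ l) else 0#

  LHS : Series → Series
  LHS F = P ⊛ F

  RHS : Series → Series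
  RHS F n = dilate (pow q N) F n
    ⊕ Σ[ 1 , r ] (λ j → Σ[ 1 , r ] (λ l → Σ[ 0 , (j ∸ 1) ⊓ (l ∸ 1) ] (λ k →
        cc k j ⊗ bb (l ∸ k) j ⊗ sgn (l ∸ 1) ⊗ shift l (dilate (pow q (j * N)) F) n)))

  FunctionalEquation : Series → Set ℓ
  FunctionalEquation F = ∀ n → LHS F n ≈ RHS F n

  -- A_{n-m} with the convention A_j := 0 for j < 0
  Aback : Series → ℕ → ℕ → Carrier
  Aback A n m = if m ≤ᵇ n then A (n ∸ m) else 0#

  Recurrence : Series → Set ℓ
  Recurrence A = ∀ n → 1 ≤ n →
    (1# − pow q (n * N)) ⊗ A n ≈
    Σ[ 1 , r ] (λ m →
      (ee m ⊕ Σ[ 1 , r ] (λ j → Σ[ 0 , (j ∸ 1) ⊓ (m ∸ 1) ] (λ k →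
          cc k j ⊗ bb (m ∸ k) j ⊗ pow q (j * N * (n ∸ m)))))
      ⊗ sgn (m + 1) ⊗ Aback A n m)

-- Compare the coefficients of x^n on both sides of the functional equation. On the left,
-- 1 + Σ_j e_j (-x)^j times F gives A_n + Σ_m e_m (-1)^m A_{n-m}; on the right, F(x q^N)
-- gives q^{nN} A_n and every correction term carries a factor x^l with l ≥ 1, so it
-- contributes c_{k,j} b_{l-k,j} (-1)^{l-1} q^{jN(n-l)} A_{n-l}. Moving A_n and the e-terms
-- across turns the coefficient equation at n ≥ 1 into the recurrence at n, while at n = 0
-- both sides are just A_0. The comparison is purely formal: none of the hypotheses on
-- r, a, N (nor A_0 = 1, which appears on both sides) is needed.
module Submission where

open import Defs
open import Level using (Level)
open import Data.Nat using (ℕ; zero; suc; _+_; _*_; _∸_; _⊓_; _≤_; _<_; _≤′_; _≤ᵇ_; z≤n; s≤s)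
open import Data.Nat.Base using (≤′-refl; ≤′-step)
import Data.Nat.Properties as ℕ
open import Data.Bool using (true; false; T; if_then_else_)
open import Data.Empty using (⊥-elim)
open import Data.Product using (_×_; _,_)
open import Data.Sum using (inj₁; inj₂)
open import Data.Fin.Subset using (Subset; Nonempty)
open import Relation.Binary.PropositionalEquality as ≡ using (_≡_)
open import Function.Bundles using (_⇔_; mk⇔; Equivalence)
open import Function.Properties.Equivalence using () renaming (trans to ⇔-trans)
open import Algebra.Bundles using (CommutativeRing)

if-≤ᵇ-then : ∀ {a} {A : Set a} {m n} {x y : A} → m ≤ n → (if m ≤ᵇ n then x else y) ≡ x
if-≤ᵇ-then {m = m} {n} m≤n with m ≤ᵇ n | ℕ.≤⇒≤ᵇ m≤n
... | true | _ = ≡.refl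

if-≤ᵇ-else : ∀ {a} {A : Set a} {m n} {x y : A} → n < m → (if m ≤ᵇ n then x else y) ≡ y
if-≤ᵇ-else {m = m} {n} n<m with m ≤ᵇ n in eq
... | false = ≡.refl
... | true  = ⊥-elim (ℕ.<⇒≱ n<m (ℕ.≤ᵇ⇒≤ m n (≡.subst T (≡.sym eq) _)))

module Coefficients {c ℓ : Level} (R : CommutativeRing c ℓ) (q d : CommutativeRing.Carrier R)
                    (a : ℕ → ℕ) (r N : ℕ) where
  open CommutativeRing R renaming (_+_ to _⊕_; _*_ to _⊗_)
  open Setting R q d a r N
  open import Algebra.Properties.Ring ring using (-0#≈0#; -1*x≈-x; -‿involutive; -‿distribˡ-*; -‿distribʳ-*)
  open import Algebra.Properties.AbelianGroup +-abelianGroup using (⁻¹-∙-comm; x∙y⁻¹≈ε⇒x≈y; x≈y⇒x∙y⁻¹≈ε)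
  open import Algebra.Properties.CommutativeSemigroup +-commutativeSemigroup using () renaming (interchange to +-interchange)
  open import Algebra.Properties.CommutativeSemigroup *-commutativeSemigroup using () renaming (interchange to *-interchange)
  open import Algebra.Properties.Semiring.Exp semiring using (_^_; ^-assocʳ)
  open import Relation.Binary.Reasoning.Setoid setoid

  Σ₁-cong : ∀ m {f g : ℕ → Carrier} → (∀ i → 1 ≤ i → i ≤ m → f i ≈ g i) →
            Σ[ 1 , m ] f ≈ Σ[ 1 , m ] g
  Σ₁-cong zero    f≈g = refl
  Σ₁-cong (suc m) f≈g = +-cong (Σ₁-cong m (λ i 1≤i i≤m → f≈g i 1≤i (ℕ.m≤n⇒m≤1+n i≤m)))
                               (f≈g (suc m) (s≤s z≤n) ℕ.≤-refl)

  Σ₀-cong : ∀ m {f g : ℕ → Carrier} → (∀ i → f i ≈ g i) → Σ[ 0 , m ] f ≈ Σ[ 0 , m ] g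
  Σ₀-cong zero    f≈g = +-congˡ (f≈g 0)
  Σ₀-cong (suc m) f≈g = +-cong (Σ₀-cong m f≈g) (f≈g (suc m))

  Σ₁-vanish : ∀ m {f : ℕ → Carrier} → (∀ i → 1 ≤ i → i ≤ m → f i ≈ 0#) → Σ[ 1 , m ] f ≈ 0#
  Σ₁-vanish zero    f≈0 = refl
  Σ₁-vanish (suc m) f≈0 = trans (+-cong (Σ₁-vanish m (λ i 1≤i i≤m → f≈0 i 1≤i (ℕ.m≤n⇒m≤1+n i≤m)))
                                        (f≈0 (suc m) (s≤s z≤n) ℕ.≤-refl))
                                 (+-identityˡ 0#)

  Σ₀-vanish : ∀ m {f : ℕ → Carrier} → (∀ i → f i ≈ 0#) → Σ[ 0 , m ] f ≈ 0#
  Σ₀-vanish m f≈0 = trans (Σ₀-cong m f≈0) (zero-sum m)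
    where
    zero-sum : ∀ m → Σ[ 0 , m ] (λ _ → 0#) ≈ 0#
    zero-sum zero    = +-identityˡ 0#
    zero-sum (suc m) = trans (+-identityʳ _) (zero-sum m)

  Σ₀-split : ∀ m f → Σ[ 0 , m ] f ≈ f 0 ⊕ Σ[ 1 , m ] f
  Σ₀-split zero    f = +-comm 0# (f 0)
  Σ₀-split (suc m) f = trans (+-congʳ (Σ₀-split m f)) (+-assoc _ _ _)

  Σ₁-distribʳ : ∀ m f x → Σ[ 1 , m ] f ⊗ x ≈ Σ[ 1 , m ] (λ i → f i ⊗ x)
  Σ₁-distribʳ zero    f x = zeroˡ x
  Σ₁-distribʳ (suc m) f x = trans (distribʳ x _ _) (+-congʳ (Σ₁-distribʳ m f x))

  Σ₀-distribʳ : ∀ m f x → Σ[ 0 , m ] f ⊗ x ≈ Σ[ 0 , m ] (λ i → f i ⊗ x)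
  Σ₀-distribʳ zero    f x = trans (distribʳ x _ _) (+-congʳ (zeroˡ x))
  Σ₀-distribʳ (suc m) f x = trans (distribʳ x _ _) (+-congʳ (Σ₀-distribʳ m f x))

  Σ₁-+ : ∀ m f g → Σ[ 1 , m ] (λ i → f i ⊕ g i) ≈ Σ[ 1 , m ] f ⊕ Σ[ 1 , m ] g
  Σ₁-+ zero    f g = sym (+-identityˡ 0#)
  Σ₁-+ (suc m) f g = trans (+-congʳ (Σ₁-+ m f g)) (+-interchange _ _ _ _)

  Σ₁-neg : ∀ m f → Σ[ 1 , m ] (λ i → - f i) ≈ - Σ[ 1 , m ] f
  Σ₁-neg zero    f = sym -0#≈0#
  Σ₁-neg (suc m) f = trans (+-congʳ (Σ₁-neg m f)) (⁻¹-∙-comm _ _)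

  Σ₁-swap : ∀ m n (f : ℕ → ℕ → Carrier) →
            Σ[ 1 , m ] (λ i → Σ[ 1 , n ] (f i)) ≈ Σ[ 1 , n ] (λ j → Σ[ 1 , m ] (λ i → f i j))
  Σ₁-swap zero    n f = sym (Σ₁-vanish n (λ _ _ _ → refl))
  Σ₁-swap (suc m) n f = trans (+-congʳ (Σ₁-swap m n f)) (sym (Σ₁-+ n _ _))

  Σ₁-tail : ∀ {K n} f → K ≤′ n → (∀ i → K < i → i ≤ n → f i ≈ 0#) → Σ[ 1 , n ] f ≈ Σ[ 1 , K ] f
  Σ₁-tail f ≤′-refl        f≈0 = refl
  Σ₁-tail f (≤′-step K≤′n) f≈0 =
    trans (+-cong (Σ₁-tail f K≤′n (λ i K<i i≤n → f≈0 i K<i (ℕ.m≤n⇒m≤1+n i≤n)))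
                  (f≈0 _ (s≤s (ℕ.≤′⇒≤ K≤′n)) ℕ.≤-refl))
          (+-identityʳ _)

  Σ₁-truncate : ∀ K n f → (∀ i → K < i → i ≤ n → f i ≈ 0#) → Σ[ 1 , n ] f ≈ Σ[ 1 , n ⊓ K ] f
  Σ₁-truncate K n f f≈0 with ℕ.≤-total n K
  ... | inj₁ n≤K rewrite ℕ.m≤n⇒m⊓n≡m n≤K = refl
  ... | inj₂ K≤n rewrite ℕ.m≥n⇒m⊓n≡n K≤n = Σ₁-tail f (ℕ.≤⇒≤′ K≤n) f≈0

  pow≡^ : ∀ x n → pow x n ≡ x ^ n
  pow≡^ x zero    = ≡.refl
  pow≡^ x (suc n) = ≡.cong (x ⊗_) (pow≡^ x n)

  pow-pow : ∀ x m n → pow (pow x m) n ≈ pow x (m * n)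
  pow-pow x m n rewrite pow≡^ (pow x m) n | pow≡^ x m | pow≡^ x (m * n) = ^-assocʳ x m n

  sgn-+1 : ∀ m → sgn (m + 1) ≈ - sgn m
  sgn-+1 m rewrite ℕ.+-comm m 1 = -1*x≈-x (sgn m)

  sgn-suc-+1 : ∀ m → sgn (suc m + 1) ≈ sgn m
  sgn-suc-+1 m = trans (sgn-+1 (suc m)) (trans (-‿cong (-1*x≈-x (sgn m))) (-‿involutive (sgn m)))

  ≈-resp-⇔ : ∀ {x x′ y y′} → x ≈ x′ → y ≈ y′ → (x ≈ y) ⇔ (x′ ≈ y′)
  ≈-resp-⇔ x≈x′ y≈y′ = mk⇔ (λ x≈y → trans (sym x≈x′) (trans x≈y y≈y′))
                           (λ x′≈y′ → trans x≈x′ (trans x′≈y′ (sym y≈y′)))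

  +-transpose : ∀ w x y z → (w ⊕ x ≈ y ⊕ z) ⇔ (w − y ≈ - x ⊕ z)
  +-transpose w x y z = mk⇔
    (λ eq → x∙y⁻¹≈ε⇒x≈y _ _ (trans difference (x≈y⇒x∙y⁻¹≈ε eq)))
    (λ eq → x∙y⁻¹≈ε⇒x≈y _ _ (trans (sym difference) (x≈y⇒x∙y⁻¹≈ε eq)))
    where
    difference : (w − y) − (- x ⊕ z) ≈ (w ⊕ x) − (y ⊕ z)
    difference = begin
      (w ⊕ - y) ⊕ - (- x ⊕ z)    ≈⟨ +-congˡ (sym (⁻¹-∙-comm (- x) z)) ⟩
      (w ⊕ - y) ⊕ (- - x ⊕ - z)  ≈⟨ +-congˡ (+-congʳ (-‿involutive x)) ⟩
      (w ⊕ - y) ⊕ (x ⊕ - z)      ≈⟨ +-interchange w (- y) x (- z) ⟩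
      (w ⊕ x) ⊕ (- y ⊕ - z)      ≈⟨ +-congˡ (⁻¹-∙-comm y z) ⟩
      (w ⊕ x) ⊕ - (y ⊕ z)        ∎

  module _ (F : Series) where

    eTerm : ℕ → ℕ → Carrier
    eTerm n m = ee m ⊗ sgn m ⊗ Aback F n m

    Ptail : ℕ → Carrier
    Ptail n = Σ[ 1 , r ] (eTerm n)

    correction : ℕ → Carrier
    correction n = Σ[ 1 , r ] (λ j → Σ[ 1 , r ] (λ l → Σ[ 0 , (j ∸ 1) ⊓ (l ∸ 1) ] (λ k →
      cc k j ⊗ bb (l ∸ k) j ⊗ sgn (l ∸ 1) ⊗ shift l (dilate (pow q (j * N)) F) n)))

    recurrenceCoeff : ℕ → ℕ → Carrier
    recurrenceCoeff n m = ee m ⊕ Σ[ 1 , r ] (λ j → Σ[ 0 , (j ∸ 1) ⊓ (m ∸ 1) ] (λ k →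
      cc k j ⊗ bb (m ∸ k) j ⊗ pow q (j * N * (n ∸ m))))

    LHS≈ : ∀ n → LHS F n ≈ F n ⊕ Ptail n
    LHS≈ n = trans (Σ₀-split n _) (+-cong (*-identityˡ (F n)) P-part)
      where
      P-part : Σ[ 1 , n ] (λ i → P i ⊗ F (n ∸ i)) ≈ Ptail n
      P-part = begin
        Σ[ 1 , n ] (λ i → P i ⊗ F (n ∸ i))
          ≈⟨ Σ₁-truncate r n _ (λ { (suc j) r<i _ → trans (*-congʳ (reflexive (if-≤ᵇ-else r<i))) (zeroˡ _) }) ⟩
        Σ[ 1 , n ⊓ r ] (λ i → P i ⊗ F (n ∸ i))
          ≈⟨ Σ₁-cong (n ⊓ r) (λ { (suc j) _ i≤n⊓r →
               reflexive (≡.cong₂ _⊗_ (if-≤ᵇ-then (ℕ.≤-trans i≤n⊓r (ℕ.m⊓n≤n n r)))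
                                      (≡.sym (if-≤ᵇ-then (ℕ.≤-trans i≤n⊓r (ℕ.m⊓n≤m n r))))) }) ⟩
        Σ[ 1 , n ⊓ r ] (eTerm n)
          ≡⟨ ≡.cong (λ k → Σ[ 1 , k ] (eTerm n)) (ℕ.⊓-comm n r) ⟩
        Σ[ 1 , r ⊓ n ] (eTerm n)
          ≈⟨ Σ₁-truncate n r _ (λ i n<i _ → trans (*-congˡ (reflexive (if-≤ᵇ-else n<i))) (zeroʳ _)) ⟨
        Ptail n ∎

    pow-Aback≈shift : ∀ n j m →
      pow q (j * N * (n ∸ m)) ⊗ Aback F n m ≈ shift m (dilate (pow q (j * N)) F) n
    pow-Aback≈shift n j m with m ≤ᵇ n
    ... | true  = *-congʳ (sym (pow-pow q (j * N) (n ∸ m)))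
    ... | false = zeroʳ _

    recurrence-sum≈ : ∀ n →
      Σ[ 1 , r ] (λ m → recurrenceCoeff n m ⊗ sgn (m + 1) ⊗ Aback F n m) ≈ - Ptail n ⊕ correction n
    recurrence-sum≈ n = begin
      Σ[ 1 , r ] (λ m → (ee m ⊕ C m) ⊗ sgn (m + 1) ⊗ Aback F n m)
        ≈⟨ Σ₁-cong r (λ m _ _ → trans (*-congʳ (distribʳ _ _ _)) (distribʳ _ _ _)) ⟩
      Σ[ 1 , r ] (λ m → ee m ⊗ sgn (m + 1) ⊗ Aback F n m ⊕ C m ⊗ sgn (m + 1) ⊗ Aback F n m)
        ≈⟨ Σ₁-+ r _ _ ⟩
      Σ[ 1 , r ] (λ m → ee m ⊗ sgn (m + 1) ⊗ Aback F n m) ⊕ Σ[ 1 , r ] (λ m → C m ⊗ sgn (m + 1) ⊗ Aback F n m)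
        ≈⟨ +-cong (trans (Σ₁-cong r (λ m _ _ → sign-flip m)) (Σ₁-neg r _))
                  (trans (Σ₁-cong r C-term) (Σ₁-swap r r _)) ⟩
      - Ptail n ⊕ correction n ∎
      where
      C : ℕ → Carrier
      C m = Σ[ 1 , r ] (λ j → Σ[ 0 , (j ∸ 1) ⊓ (m ∸ 1) ] (λ k →
              cc k j ⊗ bb (m ∸ k) j ⊗ pow q (j * N * (n ∸ m))))

      sign-flip : ∀ m → ee m ⊗ sgn (m + 1) ⊗ Aback F n m ≈ - eTerm n m
      sign-flip m = begin
        ee m ⊗ sgn (m + 1) ⊗ Aback F n m  ≈⟨ *-congʳ (*-congˡ (sgn-+1 m)) ⟩
        ee m ⊗ - sgn m ⊗ Aback F n m      ≈⟨ *-congʳ (-‿distribʳ-* (ee m) (sgn m)) ⟨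
        - (ee m ⊗ sgn m) ⊗ Aback F n m    ≈⟨ -‿distribˡ-* _ _ ⟨
        - eTerm n m                       ∎

      C-term : ∀ m → 1 ≤ m → m ≤ r →
        C m ⊗ sgn (m + 1) ⊗ Aback F n m ≈
        Σ[ 1 , r ] (λ j → Σ[ 0 , (j ∸ 1) ⊓ (m ∸ 1) ] (λ k →
          cc k j ⊗ bb (m ∸ k) j ⊗ sgn (m ∸ 1) ⊗ shift m (dilate (pow q (j * N)) F) n))
      C-term (suc m) _ _ =
        trans (*-assoc _ _ _)
        (trans (Σ₁-distribʳ r _ _)
        (Σ₁-cong r (λ j _ _ → trans (Σ₀-distribʳ ((j ∸ 1) ⊓ m) _ _) (Σ₀-cong ((j ∸ 1) ⊓ m) (λ k →
          trans (*-interchange (cc k j ⊗ bb (suc m ∸ k) j) _ _ _)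
                (*-cong (*-congˡ (sgn-suc-+1 m)) (pow-Aback≈shift n j (suc m))))))))

    recurrence-lhs≈ : ∀ n → (1# − pow q (n * N)) ⊗ F n ≈ F n − dilate (pow q N) F n
    recurrence-lhs≈ n = begin
      (1# ⊕ - pow q (n * N)) ⊗ F n        ≈⟨ distribʳ (F n) 1# _ ⟩
      1# ⊗ F n ⊕ - pow q (n * N) ⊗ F n    ≈⟨ +-cong (*-identityˡ (F n)) (sym (-‿distribˡ-* _ (F n))) ⟩
      F n ⊕ - (pow q (n * N) ⊗ F n)       ≈⟨ +-congˡ (-‿cong (*-congʳ q^nN≈[q^N]^n)) ⟩
      F n ⊕ - (pow (pow q N) n ⊗ F n)     ∎
      where
      q^nN≈[q^N]^n : pow q (n * N) ≈ pow (pow q N) n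
      q^nN≈[q^N]^n = trans (reflexive (≡.cong (pow q) (ℕ.*-comm n N))) (sym (pow-pow q N n))

    coefficient-equation-at-0 : LHS F 0 ≈ RHS F 0
    coefficient-equation-at-0 = trans (+-comm 0# _) (+-congˡ (sym correction-at-0))
      where
      correction-at-0 : correction 0 ≈ 0#
      correction-at-0 = Σ₁-vanish r (λ j _ _ → Σ₁-vanish r (λ { (suc l) _ _ →
                          Σ₀-vanish ((j ∸ 1) ⊓ l) (λ _ → zeroʳ _) }))

    coefficient-equation⇔recurrence : ∀ n →
      (LHS F n ≈ RHS F n) ⇔
      ((1# − pow q (n * N)) ⊗ F n ≈ Σ[ 1 , r ] (λ m → recurrenceCoeff n m ⊗ sgn (m + 1) ⊗ Aback F n m))
    coefficient-equation⇔recurrence n =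
      ⇔-trans (≈-resp-⇔ (LHS≈ n) refl)
      (⇔-trans (+-transpose (F n) (Ptail n) (dilate (pow q N) F n) (correction n))
               (≈-resp-⇔ (sym (recurrence-lhs≈ n)) (sym (recurrence-sum≈ n))))

lemma5 : ∀ {c ℓ : Level} (R : CommutativeRing c ℓ)
         (r : ℕ) → 1 ≤ r →
         (a : ℕ → ℕ) →
         (∀ k → 1 ≤ k → k ≤ r → natSum 1 (k ∸ 1) a < a k) →
         (∀ (S T : Subset r) → Nonempty S → Nonempty T →
            subsetSum a S ≡ subsetSum a T → S ≡ T) →
         (N : ℕ) → natSum 1 r a ≤ N →
         (q d : CommutativeRing.Carrier R) →
         (A : ℕ → CommutativeRing.Carrier R) →
         ((CommutativeRing._≈_ R (A 0) (CommutativeRing.1# R)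
             × Setting.FunctionalEquation R q d a r N A)
          ⇔ (CommutativeRing._≈_ R (A 0) (CommutativeRing.1# R)
             × Setting.Recurrence R q d a r N A))
lemma5 R r _ a _ _ N _ q d A = mk⇔
  (λ (A₀≈1 , equation) → A₀≈1 , λ n _ → to (coefficient-equation⇔recurrence A n) (equation n))
  (λ (A₀≈1 , recurrence) → A₀≈1 , λ where
     zero    → coefficient-equation-at-0 A
     (suc n) → from (coefficient-equation⇔recurrence A (suc n)) (recurrence (suc n) (s≤s z≤n)))
  where
  open Coefficients R q d a r N
  open Equivalence
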